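{- If $T$ is a tree in the family $\mathcal{F}$ with $n_1$ leaves, then $F_t(T) = n_1$.
   Context: Forcing process: given a graph $G$ and an initial set $S \subseteq V(G)$ of colored vertices, at each step a colored vertex that has exactly one non-colored neighbor forces (colors) that neighbor. $S$ is a forcing set if iterating this eventually colors all of $V(G)$. A total forcing set (TF-set) is a forcing set $S$ such that $G[S]$ has no isolated vertex; $F_t(G)$ is the minimum cardinality of a TF-set. A leaf is a vertex of degree $1$; a strong support vertex is a vertex adjacent to at least two leaves. The family $\mathcal{F}$ is the smallest family of trees containing $P_2$ and closed under the operations producing $T$ from $T'$: (O1) if $uv$ is an edge of $T'$ with at least one of $u,v$ of degree at most $2$, subdivide $uv$ once; (O2) if $v$ is a strong support vertex of $T'$, add a new leaf adjacent to $v$; (O3) if $w$ is a strong support vertex of $T'$ and $v$ a leaf neighbor of $w$, add two new leaves adjacent to $v$; (O4) if $v$ has degree at least $2$ in $T'$, add a new path $xyz$ and the edge $vy$; (O5) if $v$ has degree at least $2$ in $T'$, add new vertices $u_1,v_1,v_2,v_3,v_4,u_3$ with edges $u_1v_1, v_1v_2, v_2v_3, v_3v_4, v_3u_3$ and the edge $vv_1$. -}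

module Defs where

open import Data.Nat using (ℕ; zero; suc; _+_; _≤_)
open import Data.Nat.Base using (_≡ᵇ_)
open import Data.Bool using (Bool; true; false; _∧_; _∨_; not; if_then_else_; T)
open import Data.Fin using (Fin; zero; suc; toℕ; splitAt)
open import Data.Fin.Properties using (_≟_)
open import Data.Sum using (_⊎_; inj₁; inj₂)
open import Data.Product using (Σ; Σ-syntax; _×_; _,_)
open import Data.List using (List; []; _∷_)
open import Data.Bool.ListAction using (any)
open import Relation.Binary.PropositionalEquality using (_≡_; _≢_)
open import Relation.Nullary.Decidable using (⌊_⌋)
open import Function.Bundles using (_↔_; Inverse)

-- Simple graphs on vertex set Fin n, given by a Boolean adjacency
-- function.  All graphs built below are symmetric and loopless.

Graph : ℕ → Set
Graph n = Fin n → Fin n → Bool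

Adj : ∀ {n} → Graph n → Fin n → Fin n → Set
Adj G u v = T (G u v)

_==_ : ∀ {n} → Fin n → Fin n → Bool
a == b = ⌊ a ≟ b ⌋

count : ∀ {n} → (Fin n → Bool) → ℕ
count {zero}  f = 0
count {suc n} f = (if f zero then 1 else 0) + count (λ i → f (suc i))

deg : ∀ {n} → Graph n → Fin n → ℕ
deg G v = count (G v)

IsLeaf : ∀ {n} → Graph n → Fin n → Set
IsLeaf G v = deg G v ≡ 1

leafCount : ∀ {n} → Graph n → ℕ
leafCount G = count (λ v → deg G v ≡ᵇ 1)

StrongSupport : ∀ {n} → Graph n → Fin n → Set
StrongSupport G v = Σ[ a ∈ _ ] Σ[ b ∈ _ ]
  (a ≢ b × Adj G v a × Adj G v b × IsLeaf G a × IsLeaf G b)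

-- Colored G S is the final set of colored vertices of the forcing
-- process started from S: the least set containing S and closed under
-- the forcing rule (a colored vertex u all of whose neighbours other
-- than v are colored forces its neighbour v).

data Colored {n} (G : Graph n) (S : Fin n → Bool) : Fin n → Set where
  initial : ∀ {v} → T (S v) → Colored G S v
  force   : ∀ {u v} → Colored G S u → Adj G u v →
            (∀ w → Adj G u w → w ≢ v → Colored G S w) →
            Colored G S v

ForcingSet : ∀ {n} → Graph n → (Fin n → Bool) → Set
ForcingSet G S = ∀ v → Colored G S v

NoIsolated : ∀ {n} → Graph n → (Fin n → Bool) → Set
NoIsolated G S = ∀ v → T (S v) → Σ[ u ∈ _ ] (T (S u) × Adj G v u)

TFSet : ∀ {n} → Graph n → (Fin n → Bool) → Set
TFSet G S = ForcingSet G S × NoIsolated G S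

size : ∀ {n} → (Fin n → Bool) → ℕ
size S = count S

TotalForcingNumberIs : ∀ {n} → Graph n → ℕ → Set
TotalForcingNumberIs G k =
  (Σ[ S ∈ _ ] (TFSet G S × size S ≡ k)) ×
  (∀ S → TFSet G S → k ≤ size S)

fromEdges : ∀ {k} → List (ℕ × ℕ) → Graph k
fromEdges es i j = any (λ { (a , b) →
  ((toℕ i ≡ᵇ a) ∧ (toℕ j ≡ᵇ b)) ∨ ((toℕ j ≡ᵇ a) ∧ (toℕ i ≡ᵇ b)) }) es

-- disjoint union of a gadget H on Fin k (new vertices) with G on Fin n
-- (old vertices), plus edges C i b between new vertex i and old vertex b
attach : ∀ k {n} → Graph k → (Fin k → Fin n → Bool) → Graph n → Graph (k + n)
attach k H C G x y with splitAt k x | splitAt k y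
... | inj₁ i | inj₁ j = H i j
... | inj₂ a | inj₂ b = G a b
... | inj₁ i | inj₂ b = C i b
... | inj₂ a | inj₁ j = C j a

removeEdge : ∀ {n} → Graph n → Fin n → Fin n → Graph n
removeEdge G u v a b = G a b ∧ not (((a == u) ∧ (b == v)) ∨ ((a == v) ∧ (b == u)))

P₂ : Graph 2
P₂ = fromEdges ((0 , 1) ∷ [])

subdivide : ∀ {n} → Graph n → Fin n → Fin n → Graph (1 + n)
subdivide G u v = attach 1 (fromEdges []) (λ _ b → (b == u) ∨ (b == v)) (removeEdge G u v)

addLeaf : ∀ {n} → Graph n → Fin n → Graph (1 + n)
addLeaf G v = attach 1 (fromEdges []) (λ _ b → b == v) G

addTwoLeaves : ∀ {n} → Graph n → Fin n → Graph (2 + n)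
addTwoLeaves G v = attach 2 (fromEdges []) (λ _ b → b == v) G

addP₃ : ∀ {n} → Graph n → Fin n → Graph (3 + n)
addP₃ G v = attach 3 (fromEdges ((0 , 1) ∷ (1 , 2) ∷ []))
                     (λ i b → (toℕ i ≡ᵇ 1) ∧ (b == v)) G

-- (O5) new vertices u₁=0, v₁=1, v₂=2, v₃=3, v₄=4, u₃=5 with edges
-- u₁v₁, v₁v₂, v₂v₃, v₃v₄, v₃u₃, and the edge v v₁
addO5 : ∀ {n} → Graph n → Fin n → Graph (6 + n)
addO5 G v = attach 6 (fromEdges ((0 , 1) ∷ (1 , 2) ∷ (2 , 3) ∷ (3 , 4) ∷ (3 , 5) ∷ []))
                     (λ i b → (toℕ i ≡ᵇ 1) ∧ (b == v)) G

-- The family 𝓕 (closed under isomorphism, as a family of trees is)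

data InF : (n : ℕ) → Graph n → Set where
  p₂  : InF 2 P₂
  o₁  : ∀ {n G} → InF n G → (u v : Fin n) → Adj G u v →
        (deg G u ≤ 2 ⊎ deg G v ≤ 2) → InF (1 + n) (subdivide G u v)
  o₂  : ∀ {n G} → InF n G → (v : Fin n) → StrongSupport G v →
        InF (1 + n) (addLeaf G v)
  o₃  : ∀ {n G} → InF n G → (w v : Fin n) → StrongSupport G w →
        Adj G w v → IsLeaf G v → InF (2 + n) (addTwoLeaves G v)
  o₄  : ∀ {n G} → InF n G → (v : Fin n) → 2 ≤ deg G v →
        InF (3 + n) (addP₃ G v)
  o₅  : ∀ {n G} → InF n G → (v : Fin n) → 2 ≤ deg G v →
        InF (6 + n) (addO5 G v)
  iso : ∀ {n G H} → InF n G → (σ : Fin n ↔ Fin n) →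
        (∀ a b → H (Inverse.to σ a) (Inverse.to σ b) ≡ G a b) → InF n H

module Submission where

-- Forcing is handled through certificates: a rank r and a forcer map p such
-- that each uncolored vertex y is adjacent to p y, and p y and its other
-- neighbours are initially colored or ranked below y.  Certificates are
-- sound, and complete: rank each vertex by the first forcing round coloring it.
--
-- Lower bound (any symmetric graph): for a TF-set S the forcer map is
-- injective on V ∖ S and avoids leaves, so |V ∖ S| ≤ |V ∖ leaves|, |S| ≥ n₁.
-- Upper bound: along the construction of 𝓕 we carry a tight TF-set (of size
-- n₁) with a certificate; P₂ has one, and O1-O5 and isomorphisms preserve it.

open import Defs
open import Data.Nat using (ℕ; zero; suc; _+_; _≤_; _<_; z≤n; s≤s; _⊔_; _≤′_; ≤′-refl; ≤′-step)
open import Data.Nat.Base using (_≡ᵇ_)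
import Data.Nat.Properties as ℕ
open import Data.Bool using (Bool; true; false; _∧_; _∨_; not; if_then_else_; T)
open import Data.Bool.Properties
  using (T-≡; T-∧; T-∨; T?; ¬-not; ∨-comm; ∧-comm; ∧-inverseʳ; ∧-identityʳ; ∨-identityʳ; ∧-zeroʳ; ∨-zeroʳ)
open import Data.Fin using (Fin; zero; suc; toℕ; splitAt)
open import Data.Fin.Properties using (_≟_; suc-injective; 0≢1+n; any?; all?)
open import Data.Sum using (_⊎_; inj₁; inj₂)
open import Data.Product using (Σ-syntax; ∃-syntax; _×_; _,_; proj₁; proj₂)
open import Data.List using (List; []; _∷_)
open import Data.Empty using (⊥; ⊥-elim)
open import Data.Unit using (tt)
open import Relation.Binary.PropositionalEquality
open import Relation.Nullary using (¬_; yes; no; Dec)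
open import Relation.Nullary.Decidable
  using (toWitness; fromWitness; _×-dec_; _⊎-dec_; _→-dec_; ¬?)
open import Function.Bundles using (_↔_; Inverse; Equivalence)
open import Function.Construct.Identity using (↔-id)

true⇒T : ∀ {b} → b ≡ true → T b
true⇒T = Equivalence.from T-≡

T⇒true : ∀ {b} → T b → b ≡ true
T⇒true = Equivalence.to T-≡

false⇒¬T : ∀ {b} → b ≡ false → ¬ T b
false⇒¬T refl ()

¬T⇒false : ∀ {b} → ¬ T b → b ≡ false
¬T⇒false ¬b = ¬-not (λ b≡true → ¬b (true⇒T b≡true))

T-∧⁻ : ∀ {a b} → T (a ∧ b) → T a × T b
T-∧⁻ = Equivalence.to T-∧

T-∨⁻ : ∀ {a b} → T (a ∨ b) → T a ⊎ T b
T-∨⁻ = Equivalence.to T-∨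

T-∨⁺ : ∀ {a b} → T a ⊎ T b → T (a ∨ b)
T-∨⁺ = Equivalence.from T-∨

-- A copy of _≟_ that is not syntactically part of a == b, so that a
-- 'with' on it does not abstract over the Boolean tests inside the goal.
_≟ᵥ_ : ∀ {n} (a b : Fin n) → Dec (a ≡ b)
a ≟ᵥ b with a ≟ b
... | yes e = yes e
... | no e = no e

==-refl : ∀ {n} (a : Fin n) → (a == a) ≡ true
==-refl a = T⇒true (fromWitness {a? = a ≟ a} refl)

==-≢ : ∀ {n} {a b : Fin n} → a ≢ b → (a == b) ≡ false
==-≢ {a = a} {b} a≢b = ¬T⇒false (λ t → a≢b (toWitness {a? = a ≟ b} t))

==⇒≡ : ∀ {n} {a b : Fin n} → T (a == b) → a ≡ b
==⇒≡ {a = a} {b} t = toWitness {a? = a ≟ b} t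

indicator : Bool → ℕ
indicator b = if b then 1 else 0

count-ext : ∀ {n} {f g : Fin n → Bool} → (∀ x → f x ≡ g x) → count f ≡ count g
count-ext {zero} h = refl
count-ext {suc n} {f} {g} h =
  cong₂ _+_ (cong indicator (h zero)) (count-ext (λ x → h (suc x)))

count-none : ∀ {n} (f : Fin n → Bool) → (∀ x → f x ≡ false) → count f ≡ 0
count-none {zero} f h = refl
count-none {suc n} f h rewrite h zero = count-none (λ x → f (suc x)) (λ x → h (suc x))

count-remove : ∀ {n} (f : Fin n → Bool) (y : Fin n) → f y ≡ true →
  count f ≡ suc (count (λ z → f z ∧ not (z == y)))
count-remove {suc n} f zero e rewrite e | ==-refl {suc n} zero =
  cong suc (count-ext λ x → sym (trans (cong (λ q → f (suc x) ∧ not q) (==-≢ {a = suc x} {b = zero} λ ()))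
                                        (∧-identityʳ _)))
count-remove {suc n} f (suc y) e
  rewrite count-remove (λ i → f (suc i)) y e
        | ==-≢ {a = zero {n}} {b = suc y} (λ ()) | ∧-identityʳ (f zero) =
  trans (ℕ.+-suc _ _) (cong (λ q → suc (indicator (f zero) + q))
    (count-ext λ x → cong (λ q → f (suc x) ∧ not q) (sym (==-suc x y))))
  where
  ==-suc : ∀ (a b : Fin n) → (suc a == suc b) ≡ (a == b)
  ==-suc a b with a ≟ b
  ... | yes refl = refl
  ... | no _ = refl

count-flip : ∀ {n} (f g : Fin n → Bool) (y : Fin n) → f y ≡ true → g y ≡ false →
  (∀ x → x ≢ y → g x ≡ f x) → count f ≡ suc (count g)
count-flip f g y fy gy agree = trans (count-remove f y fy) (cong suc (count-ext pointwise))
  where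
  pointwise : ∀ x → (f x ∧ not (x == y)) ≡ g x
  pointwise x with x ≟ y
  ... | yes refl = trans (∧-zeroʳ (f x)) (sym gy)
  ... | no x≢y = trans (∧-identityʳ (f x)) (sym (agree x x≢y))

count-swap : ∀ {n} (f g : Fin n → Bool) (y₁ y₂ : Fin n) → f y₁ ≡ true → f y₂ ≡ false →
  g y₁ ≡ false → g y₂ ≡ true → (∀ x → x ≢ y₁ → x ≢ y₂ → g x ≡ f x) → count f ≡ count g
count-swap f g y₁ y₂ f₁ f₂ g₁ g₂ agree =
  trans (count-flip f common y₁ f₁ common-y₁ fromF) (sym (count-flip g common y₂ g₂ common-y₂ fromG))
  where
  -- f with y₁ removed, which is also g with y₂ removed
  common : _ → Bool
  common x = f x ∧ not (x == y₁)
  common-y₁ : common y₁ ≡ false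
  common-y₁ = trans (cong (λ q → f y₁ ∧ not q) (==-refl y₁)) (∧-zeroʳ _)
  common-y₂ : common y₂ ≡ false
  common-y₂ = cong (_∧ not (y₂ == y₁)) f₂
  fromF : ∀ x → x ≢ y₁ → common x ≡ f x
  fromF x x≢y₁ = trans (cong (λ q → f x ∧ not q) (==-≢ x≢y₁)) (∧-identityʳ _)
  fromG : ∀ x → x ≢ y₂ → common x ≡ g x
  fromG x x≢y₂ with x ≟ᵥ y₁
  ... | yes refl = trans common-y₁ (sym g₁)
  ... | no x≢y₁ = trans (fromF x x≢y₁) (sym (agree x x≢y₁ x≢y₂))

count-pos : ∀ {n} (f : Fin n → Bool) (y : Fin n) → f y ≡ true → 0 < count f
count-pos f y e rewrite count-remove f y e = s≤s z≤n

count-witness : ∀ {n} (f : Fin n → Bool) → 0 < count f → Σ[ x ∈ Fin n ] f x ≡ true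
count-witness {suc n} f pos with f zero in e
... | true = zero , e
... | false = let (x , fx) = count-witness (λ i → f (suc i)) pos in suc x , fx

count-== : ∀ {n} (v : Fin n) → count (λ b → b == v) ≡ 1
count-== v = trans (count-remove (λ b → b == v) v (==-refl v))
                   (cong suc (count-none _ (λ z → ∧-inverseʳ (z == v))))

module _ {n} (f : Fin n → Bool) {a : Fin n} (fa : f a ≡ true) where
  private
    others : Fin n → Bool
    others z = f z ∧ not (z == a)
    others⁺ : ∀ {b} → f b ≡ true → b ≢ a → others b ≡ true
    others⁺ {b} fb b≢a rewrite fb | ==-≢ b≢a = refl
    others-pos : ∀ {b} → f b ≡ true → b ≢ a → 0 < count others
    others-pos fb b≢a = count-pos others _ (others⁺ fb b≢a)

  count-one-unique : count f ≡ 1 → ∀ {b} → f b ≡ true → b ≡ a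
  count-one-unique c {b} fb with b ≟ᵥ a
  ... | yes b≡a = b≡a
  ... | no b≢a = ⊥-elim (ℕ.<-irrefl (sym nothing-else) (others-pos fb b≢a))
    where
    nothing-else : count others ≡ 0
    nothing-else = ℕ.suc-injective (trans (sym (count-remove f a fa)) c)

  count-two : ∀ {b} → f b ≡ true → b ≢ a → 2 ≤ count f
  count-two fb b≢a rewrite count-remove f a fa = s≤s (others-pos fb b≢a)

count-two-other : ∀ {n} (f : Fin n → Bool) {a : Fin n} → f a ≡ true → count f ≡ 2 →
  Σ[ w ∈ Fin n ] (f w ≡ true × (∀ b → f b ≡ true → b ≡ a ⊎ b ≡ w))
count-two-other f {a} fa c = w , T⇒true (proj₁ (T-∧⁻ (true⇒T ow))) , classify
  where
  others : _ → Bool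
  others z = f z ∧ not (z == a)
  one-other : count others ≡ 1
  one-other = ℕ.suc-injective (trans (sym (count-remove f a fa)) c)
  W = count-witness others (subst (0 <_) (sym one-other) (s≤s z≤n))
  w = proj₁ W
  ow : others w ≡ true
  ow = proj₂ W
  classify : ∀ b → f b ≡ true → b ≡ a ⊎ b ≡ w
  classify b fb with b ≟ᵥ a
  ... | yes b≡a = inj₁ b≡a
  ... | no b≢a = inj₂ (count-one-unique others ow one-other ob)
    where
    ob : others b ≡ true
    ob rewrite fb | ==-≢ b≢a = refl

InjectiveOn : ∀ {n m} → (Fin n → Bool) → (Fin n → Fin m) → Set
InjectiveOn f h = ∀ x y → f x ≡ true → f y ≡ true → h x ≡ h y → x ≡ y

injectiveOn-suc : ∀ {n m} {f : Fin (suc n) → Bool} {h : Fin (suc n) → Fin m} →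
  InjectiveOn f h → InjectiveOn (λ i → f (suc i)) (λ i → h (suc i))
injectiveOn-suc inj x y fx fy eq = suc-injective (inj (suc x) (suc y) fx fy eq)

count-injection : ∀ {n m} (f : Fin n → Bool) (g : Fin m → Bool) (h : Fin n → Fin m) →
  (∀ x → f x ≡ true → g (h x) ≡ true) → InjectiveOn f h → count f ≤ count g
count-injection {zero} f g h maps inj = z≤n
count-injection {suc n} f g h maps inj with f zero in f₀
... | false = count-injection (λ i → f (suc i)) g (λ i → h (suc i)) (λ x → maps (suc x)) (injectiveOn-suc inj)
... | true rewrite count-remove g (h zero) (maps zero f₀) =
  s≤s (count-injection (λ i → f (suc i)) (λ z → g z ∧ not (z == h zero)) (λ i → h (suc i))
         maps-suc (injectiveOn-suc inj))
  where
  -- h zero is used up, so the other elements of f map to g without it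
  maps-suc : ∀ x → f (suc x) ≡ true → (g (h (suc x)) ∧ not (h (suc x) == h zero)) ≡ true
  maps-suc x fx rewrite maps (suc x) fx | ==-≢ (λ eq → 0≢1+n (sym (inj (suc x) zero fx f₀ eq))) = refl

injection-onto : ∀ {n m} (f : Fin n → Bool) (g : Fin m → Bool) (h : Fin n → Fin m) →
  (∀ x → f x ≡ true → g (h x) ≡ true) → InjectiveOn f h → count g ≤ count f →
  ∀ y → g y ≡ true → Σ[ x ∈ Fin n ] (f x ≡ true × h x ≡ y)
injection-onto f g h maps inj le y gy with any? (λ x → T? (f x ∧ (h x == y)))
... | yes (x , t) = let (fx , hx) = T-∧⁻ t in x , T⇒true fx , ==⇒≡ hx
... | no none = ⊥-elim (ℕ.<-irrefl refl (ℕ.≤-trans too-many (count-injection f g-y h maps-y inj)))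
  where
  g-y : _ → Bool
  g-y z = g z ∧ not (z == y)
  too-many : suc (count g-y) ≤ count f
  too-many = subst (_≤ count f) (count-remove g y gy) le
  maps-y : ∀ x → f x ≡ true → g-y (h x) ≡ true
  maps-y x fx rewrite maps x fx =
    cong not (¬T⇒false (λ t → none (x , Equivalence.from T-∧ (true⇒T fx , t))))

count-complement : ∀ {n} (f : Fin n → Bool) → count f + count (λ x → not (f x)) ≡ n
count-complement {zero} f = refl
count-complement {suc n} f with f zero
... | true = cong suc (count-complement (λ i → f (suc i)))
... | false = trans (ℕ.+-suc _ _) (cong suc (count-complement (λ i → f (suc i))))

count-permute : ∀ {n} (f : Fin n → Bool) (σ : Fin n ↔ Fin n) →
  count (λ x → f (Inverse.to σ x)) ≡ count f
count-permute f σ = ℕ.≤-antisym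
  (count-injection _ f to (λ x fx → fx) (λ x y _ _ eq → trans (sym (ft x)) (trans (cong fr eq) (ft y))))
  (count-injection f _ fr (λ x fx → trans (cong f (tf x)) fx)
     (λ x y _ _ eq → trans (sym (tf x)) (trans (cong to eq) (tf y))))
  where
  to = Inverse.to σ
  fr = Inverse.from σ
  tf : ∀ y → to (fr y) ≡ y
  tf = Inverse.strictlyInverseˡ σ
  ft : ∀ x → fr (to x) ≡ x
  ft = Inverse.strictlyInverseʳ σ

Earlier : ∀ {n} → (Fin n → Bool) → (Fin n → ℕ) → Fin n → Fin n → Set
Earlier S r w v = S w ≡ true ⊎ r w < r v

ForcesAt : ∀ {n} → Graph n → (Fin n → Bool) → (Fin n → ℕ) → Fin n → Fin n → Set
ForcesAt G S r u v = Adj G u v × Earlier S r u v × (∀ w → Adj G u w → w ≢ v → Earlier S r w v)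

Certificate : ∀ {n} → Graph n → (Fin n → Bool) → (Fin n → ℕ) → (Fin n → Fin n) → Set
Certificate G S r p = ∀ v → S v ≡ false → ForcesAt G S r (p v) v

certificate⇒forcing : ∀ {n} {G : Graph n} {S r p} → Certificate G S r p → ForcingSet G S
certificate⇒forcing {n} {G} {S} {r} {p} cert v = colored (suc (r v)) v (inj₂ ℕ.≤-refl)
  where
  colored : ∀ k v → S v ≡ true ⊎ r v < k → Colored G S v
  colored k v (inj₁ e) = initial (true⇒T e)
  colored (suc k) v (inj₂ rv<k) with S v in e
  ... | true = initial (true⇒T e)
  ... | false =
    let (adj , pv-earlier , others-earlier) = cert v e in
    force (colored k (p v) (below pv-earlier)) adj (λ w aw w≢v → colored k w (below (others-earlier w aw w≢v)))
    where
    below : ∀ {w} → Earlier S r w v → S w ≡ true ⊎ r w < k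
    below (inj₁ Sw) = inj₁ Sw
    below (inj₂ rw<rv) = inj₂ (ℕ.<-≤-trans rw<rv (ℕ.≤-pred rv<k))

least : (P : ℕ → Set) → (∀ k → Dec (P k)) → ∀ K → P K →
  Σ[ j ∈ ℕ ] (P j × (∀ i → P i → j ≤ i))
least P P? zero p₀ = 0 , p₀ , λ _ _ → z≤n
least P P? (suc K) pK with P? 0
... | yes p₀ = 0 , p₀ , λ _ _ → z≤n
... | no ¬p₀ =
  let (j , pj , minimal) = least (λ i → P (suc i)) (λ i → P? (suc i)) K pK in
  suc j , pj , λ { zero p → ⊥-elim (¬p₀ p) ; (suc i) p → s≤s (minimal i p) }

uniform-bound : ∀ {m} (Q : ℕ → Fin m → Set) → (∀ {k k'} w → k ≤ k' → Q k w → Q k' w) →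
  (∀ w → ∃[ k ] Q k w) → ∃[ K ] (∀ w → Q K w)
uniform-bound {zero} Q mono eventually = 0 , λ ()
uniform-bound {suc m} Q mono eventually =
  let (k₀ , q₀) = eventually zero
      (K , qs) = uniform-bound (λ k i → Q k (suc i)) (λ w → mono (suc w)) (λ w → eventually (suc w))
  in k₀ ⊔ K , λ { zero → mono zero (ℕ.m≤m⊔n k₀ K) q₀
                ; (suc w) → mono (suc w) (ℕ.m≤n⊔m k₀ K) (qs w) }

-- Completeness: the rounds of the forcing process started from a forcing
-- set S give a certificate, with r v the first round in which v is colored.
module Rounds {n} (G : Graph n) (S : Fin n → Bool) where

  Round : ℕ → Fin n → Set
  Round zero v = T (S v)
  Round (suc k) v =
    Round k v ⊎ ∃[ u ] (Round k u × Adj G u v × (∀ w → Adj G u w → w ≢ v → Round k w))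

  -- rounds are decidable, so the first round of v can be found
  round? : ∀ k v → Dec (Round k v)
  round? zero v = T? (S v)
  round? (suc k) v = round? k v ⊎-dec any? λ u →
    round? k u ×-dec T? (G u v) ×-dec all? (λ w → T? (G u w) →-dec (¬? (w ≟ v) →-dec round? k w))

  round-mono : ∀ {k k'} v → k ≤ k' → Round k v → Round k' v
  round-mono v k≤k' = mono′ (ℕ.≤⇒≤′ k≤k')
    where
    mono′ : ∀ {k k'} → k ≤′ k' → Round k v → Round k' v
    mono′ ≤′-refl r = r
    mono′ (≤′-step k≤′k') r = inj₁ (mono′ k≤′k' r)

  colored⇒round : ∀ {v} → Colored G S v → ∃[ k ] Round k v
  colored⇒round (initial t) = 0 , t
  colored⇒round {v} (force {u} colored-u adj others) =
    suc (k ⊔ K) , inj₂ (u , round-mono u (ℕ.m≤m⊔n k K) round-u , adj ,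
                        λ w aw w≢v → round-mono w (ℕ.m≤n⊔m k K) (rounds w aw w≢v))
    where
    OtherRound : ℕ → Fin n → Set
    OtherRound k w = Adj G u w → w ≢ v → Round k w
    eventually : ∀ w → ∃[ k ] OtherRound k w
    eventually w with T? (G u w) | w ≟ v
    ... | no ¬aw | _ = 0 , λ aw _ → ⊥-elim (¬aw aw)
    ... | yes _ | yes w≡v = 0 , λ _ w≢v → ⊥-elim (w≢v w≡v)
    ... | yes aw | no w≢v = let (k , r) = colored⇒round (others w aw w≢v) in k , λ _ _ → r
    u-done = colored⇒round colored-u
    others-done = uniform-bound OtherRound (λ w le q aw ne → round-mono w le (q aw ne)) eventually
    k = proj₁ u-done
    round-u = proj₂ u-done
    K = proj₁ others-done
    rounds = proj₂ others-done

  module FromForcingSet (forcing : ForcingSet G S) where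

    first : ∀ v → Σ[ j ∈ ℕ ] (Round j v × (∀ i → Round i v → j ≤ i))
    first v = let (k , r) = colored⇒round (forcing v) in least (λ k → Round k v) (λ k → round? k v) k r

    rank : Fin n → ℕ
    rank v = proj₁ (first v)

    rank-≤ : ∀ k {v} → Round k v → rank v ≤ k
    rank-≤ k {v} r = proj₂ (proj₂ (first v)) k r

    forced : ∀ {v} j → Round j v → (∀ i → Round i v → j ≤ i) → S v ≡ false →
             ∃[ u ] (Adj G u v × rank u < j × (∀ w → Adj G u w → w ≢ v → rank w < j))
    forced zero r _ Sv = ⊥-elim (false⇒¬T Sv r)
    forced (suc j) (inj₁ r) minimal _ = ⊥-elim (ℕ.<-irrefl refl (minimal j r))
    forced (suc j) (inj₂ (u , round-u , adj , others)) _ _ =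
      u , adj , s≤s (rank-≤ j round-u) , λ w aw w≢v → s≤s (rank-≤ j (others w aw w≢v))

    forcer : ∀ v → S v ≡ true ⊎ ∃[ u ] ForcesAt G S rank u v
    forcer v with S v in e
    ... | true = inj₁ refl
    ... | false =
      let (u , adj , u-earlier , others-earlier) =
            forced (rank v) (proj₁ (proj₂ (first v))) (proj₂ (proj₂ (first v))) e
      in inj₂ (u , adj , inj₂ u-earlier , λ w aw w≢v → inj₂ (others-earlier w aw w≢v))

    forcerOf : ∀ {v} → S v ≡ true ⊎ ∃[ u ] ForcesAt G S rank u v → Fin n
    forcerOf {v} (inj₁ _) = v
    forcerOf (inj₂ (u , _)) = u

    forcer-map : Fin n → Fin n
    forcer-map v = forcerOf (forcer v)

    rank-certificate : Certificate G S rank forcer-map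
    rank-certificate v Sv = certify (forcer v)
      where
      certify : (i : S v ≡ true ⊎ ∃[ u ] ForcesAt G S rank u v) → ForcesAt G S rank (forcerOf i) v
      certify (inj₁ Sv') = ⊥-elim (false⇒¬T Sv (true⇒T Sv'))
      certify (inj₂ (u , forces)) = forces

Symmetric : ∀ {n} → Graph n → Set
Symmetric G = ∀ a b → G a b ≡ G b a

Loopless : ∀ {n} → Graph n → Set
Loopless G = ∀ a → G a a ≡ false

record Simple {n} (G : Graph n) : Set where
  field
    symmetric : Symmetric G
    loopless : Loopless G

adj-sym : ∀ {n} {G : Graph n} → Symmetric G → ∀ {a b} → Adj G a b → Adj G b a
adj-sym {G = G} sym-G {a} {b} = subst T (sym-G a b)

adj-≢ : ∀ {n} {G : Graph n} → Loopless G → ∀ {a b} → Adj G a b → a ≢ b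
adj-≢ {G = G} loopless {a} adj refl = false⇒¬T (loopless a) adj

leaf-unique : ∀ {n} (G : Graph n) {l a b} → IsLeaf G l → Adj G l a → Adj G l b → a ≡ b
leaf-unique G leaf la lb = sym (count-one-unique (G _) (T⇒true la) leaf (T⇒true lb))

leaf? : ∀ {n} → Graph n → Fin n → Bool
leaf? G v = deg G v ≡ᵇ 1

leaf?-true : ∀ {n} (G : Graph n) {v} → IsLeaf G v → leaf? G v ≡ true
leaf?-true G {v} leaf = T⇒true (ℕ.≡⇒≡ᵇ (deg G v) 1 leaf)

leaf?-false : ∀ {n} (G : Graph n) {v} → ¬ IsLeaf G v → leaf? G v ≡ false
leaf?-false G {v} ¬leaf = ¬T⇒false (λ t → ¬leaf (ℕ.≡ᵇ⇒≡ (deg G v) 1 t))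

module ForcerMap {n} (G : Graph n) (sym-G : Symmetric G) (S : Fin n → Bool)
  (r : Fin n → ℕ) (p : Fin n → Fin n) (cert : Certificate G S r p) (ni : NoIsolated G S) where

  earlier-uncolored : ∀ {w v} → S w ≡ false → Earlier S r w v → r w < r v
  earlier-uncolored Sw (inj₁ Sw') = ⊥-elim (false⇒¬T Sw (true⇒T Sw'))
  earlier-uncolored Sw (inj₂ rw<rv) = rw<rv

  -- if p x = p y with x ≠ y, each of x, y must come earlier than the other
  forcer-injective : ∀ x y → S x ≡ false → S y ≡ false → p x ≡ p y → x ≡ y
  forcer-injective x y Sx Sy px≡py with x ≟ᵥ y
  ... | yes x≡y = x≡y
  ... | no x≢y = ⊥-elim (ℕ.<-asym (earlier-uncolored Sy (proj₂ (proj₂ (cert x Sx)) y py-adj-y (≢-sym x≢y)))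
                                  (earlier-uncolored Sx (proj₂ (proj₂ (cert y Sy)) x px-adj-x x≢y)))
    where
    py-adj-y : Adj G (p x) y
    py-adj-y = subst (λ q → Adj G q y) (sym px≡py) (proj₁ (cert y Sy))
    px-adj-x : Adj G (p y) x
    px-adj-x = subst (λ q → Adj G q x) px≡py (proj₁ (cert x Sx))

  -- a forcer is never a leaf: a colored leaf has its only neighbour y colored
  -- (G[S] has no isolated vertex), and an uncolored leaf p y would be forced
  -- by y while also being needed to force y
  forcer-not-leaf : ∀ y → S y ≡ false → ¬ IsLeaf G (p y)
  forcer-not-leaf y Sy leaf with S (p y) in Sl
  ... | true = let (z , Sz , az) = ni (p y) (true⇒T Sl)
               in false⇒¬T Sy (subst (λ q → T (S q)) (leaf-unique G leaf az (proj₁ (cert y Sy))) Sz)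
  ... | false = ℕ.<-asym (earlier-uncolored Sy y-before-l) (earlier-uncolored Sl (proj₁ (proj₂ (cert y Sy))))
    where
    l = p y
    pl≡y : p l ≡ y
    pl≡y = leaf-unique G leaf (adj-sym sym-G (proj₁ (cert l Sl))) (proj₁ (cert y Sy))
    y-before-l : Earlier S r y l
    y-before-l = subst (λ q → Earlier S r q l) pl≡y (proj₁ (proj₂ (cert l Sl)))

  private
    uncolored non-leaf : Fin n → Bool
    uncolored x = not (S x)
    non-leaf x = not (leaf? G x)

    uncolored⇒false : ∀ {x} → uncolored x ≡ true → S x ≡ false
    uncolored⇒false {x} e = ¬T⇒false (λ t → subst T (cong not (T⇒true t)) (true⇒T e))

    forcer-to-non-leaf : ∀ x → uncolored x ≡ true → non-leaf (p x) ≡ true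
    forcer-to-non-leaf x e = cong not (leaf?-false G (forcer-not-leaf x (uncolored⇒false e)))

    forcer-injectiveOn : InjectiveOn uncolored p
    forcer-injectiveOn x y ex ey = forcer-injective x y (uncolored⇒false ex) (uncolored⇒false ey)

    -- |S| + |V ∖ S| = n₁ + |non-leaves| = n
    split : count S + count uncolored ≡ leafCount G + count non-leaf
    split = trans (count-complement S) (sym (count-complement (leaf? G)))

    uncolored≤non-leaf : count uncolored ≤ count non-leaf
    uncolored≤non-leaf = count-injection uncolored non-leaf p forcer-to-non-leaf forcer-injectiveOn

  lower-bound : leafCount G ≤ count S
  lower-bound = ℕ.+-cancelʳ-≤ (count non-leaf) (leafCount G) (count S)
    (subst (_≤ count S + count non-leaf) split (ℕ.+-monoʳ-≤ (count S) uncolored≤non-leaf))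

  forcer-onto : count S ≡ leafCount G → ∀ u → ¬ IsLeaf G u → Σ[ y ∈ Fin n ] (S y ≡ false × p y ≡ u)
  forcer-onto |S|≡n₁ u ¬leaf =
    let (y , ey , py≡u) = injection-onto uncolored non-leaf p forcer-to-non-leaf forcer-injectiveOn
                            (ℕ.≤-reflexive (sym same-size)) u (cong not (leaf?-false G ¬leaf))
    in y , uncolored⇒false ey , py≡u
    where
    same-size : count uncolored ≡ count non-leaf
    same-size = ℕ.+-cancelˡ-≡ (count S) _ _ (trans split (cong (_+ count non-leaf) (sym |S|≡n₁)))

attach-symmetric : ∀ k {n} {H : Graph k} (C : Fin k → Fin n → Bool) {G : Graph n} →
  Symmetric H → Symmetric G → Symmetric (attach k H C G)
attach-symmetric k C sym-H sym-G x y with splitAt k x | splitAt k y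
... | inj₁ i | inj₁ j = sym-H i j
... | inj₂ a | inj₂ b = sym-G a b
... | inj₁ i | inj₂ b = refl
... | inj₂ a | inj₁ j = refl

attach-loopless : ∀ k {n} {H : Graph k} (C : Fin k → Fin n → Bool) {G : Graph n} →
  Loopless H → Loopless G → Loopless (attach k H C G)
attach-loopless k C loopless-H loopless-G x with splitAt k x
... | inj₁ i = loopless-H i
... | inj₂ a = loopless-G a

attach-simple : ∀ k {n} {H : Graph k} (C : Fin k → Fin n → Bool) {G : Graph n} →
  Simple H → Simple G → Simple (attach k H C G)
attach-simple k C simple-H simple-G = record
  { symmetric = attach-symmetric k C (Simple.symmetric simple-H) (Simple.symmetric simple-G)
  ; loopless = attach-loopless k C (Simple.loopless simple-H) (Simple.loopless simple-G) }

fromEdges-symmetric : ∀ {k} (es : List (ℕ × ℕ)) → Symmetric (fromEdges {k} es)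
fromEdges-symmetric [] i j = refl
fromEdges-symmetric ((a , b) ∷ es) i j =
  cong₂ _∨_ (∨-comm ((toℕ i ≡ᵇ a) ∧ (toℕ j ≡ᵇ b)) _) (fromEdges-symmetric es i j)

removeEdge-simple : ∀ {n} {G : Graph n} (u v : Fin n) → Simple G → Simple (removeEdge G u v)
removeEdge-simple {G = G} u v simple-G = record
  { symmetric = λ a b → cong₂ (λ x y → x ∧ not y) (Simple.symmetric simple-G a b) (swap-endpoints a b)
  ; loopless = λ a → cong (λ x → x ∧ not (((a == u) ∧ (a == v)) ∨ ((a == v) ∧ (a == u))))
                          (Simple.loopless simple-G a) }
  where
  swap-endpoints : ∀ a b → (((a == u) ∧ (b == v)) ∨ ((a == v) ∧ (b == u)))
                         ≡ (((b == u) ∧ (a == v)) ∨ ((b == v) ∧ (a == u)))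
  swap-endpoints a b = trans (cong₂ _∨_ (∧-comm (a == u) (b == v)) (∧-comm (a == v) (b == u)))
                             (∨-comm ((b == v) ∧ (a == u)) ((b == u) ∧ (a == v)))

iso-simple : ∀ {n} {G H : Graph n} → Simple G → (σ : Fin n ↔ Fin n) →
  (∀ a b → H (Inverse.to σ a) (Inverse.to σ b) ≡ G a b) → Simple H
iso-simple {G = G} {H} simple-G σ σ-iso = record
  { symmetric = λ a b → trans (H≡G a b) (trans (Simple.symmetric simple-G _ _) (sym (H≡G b a)))
  ; loopless = λ a → trans (H≡G a a) (Simple.loopless simple-G _) }
  where
  H≡G : ∀ x y → H x y ≡ G (Inverse.from σ x) (Inverse.from σ y)
  H≡G x y = trans (sym (cong₂ H (Inverse.strictlyInverseˡ σ x) (Inverse.strictlyInverseˡ σ y)))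
                  (σ-iso (Inverse.from σ x) (Inverse.from σ y))

edgeless-simple : ∀ {k} → Simple (fromEdges {k} [])
edgeless-simple = record { symmetric = λ _ _ → refl ; loopless = λ _ → refl }

path-simple : Simple (fromEdges {3} ((0 , 1) ∷ (1 , 2) ∷ []))
path-simple = record { symmetric = fromEdges-symmetric ((0 , 1) ∷ (1 , 2) ∷ []) ; loopless = loopless }
  where
  loopless : Loopless (fromEdges {3} ((0 , 1) ∷ (1 , 2) ∷ []))
  loopless zero = refl
  loopless (suc zero) = refl
  loopless (suc (suc zero)) = refl

spider-simple : Simple (fromEdges {6} ((0 , 1) ∷ (1 , 2) ∷ (2 , 3) ∷ (3 , 4) ∷ (3 , 5) ∷ []))
spider-simple = record
  { symmetric = fromEdges-symmetric ((0 , 1) ∷ (1 , 2) ∷ (2 , 3) ∷ (3 , 4) ∷ (3 , 5) ∷ []) ; loopless = loopless }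
  where
  loopless : Loopless (fromEdges {6} ((0 , 1) ∷ (1 , 2) ∷ (2 , 3) ∷ (3 , 4) ∷ (3 , 5) ∷ []))
  loopless zero = refl
  loopless (suc zero) = refl
  loopless (suc (suc zero)) = refl
  loopless (suc (suc (suc zero))) = refl
  loopless (suc (suc (suc (suc zero)))) = refl
  loopless (suc (suc (suc (suc (suc zero))))) = refl

inF-simple : ∀ {n} {G : Graph n} → InF n G → Simple G
inF-simple p₂ = record
  { symmetric = fromEdges-symmetric ((0 , 1) ∷ [])
  ; loopless = λ { zero → refl ; (suc zero) → refl } }
inF-simple (o₁ i u v _ _) = attach-simple 1 _ edgeless-simple (removeEdge-simple u v (inF-simple i))
inF-simple (o₂ i v _) = attach-simple 1 _ edgeless-simple (inF-simple i)
inF-simple (o₃ i w v _ _ _) = attach-simple 2 _ edgeless-simple (inF-simple i)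
inF-simple (o₄ i v _) = attach-simple 3 _ path-simple (inF-simple i)
inF-simple (o₅ i v _) = attach-simple 6 _ spider-simple (inF-simple i)
inF-simple (iso i σ eq) = iso-simple (inF-simple i) σ eq

record Tight {n} (G : Graph n) : Set where
  field
    S : Fin n → Bool
    r : Fin n → ℕ
    p : Fin n → Fin n
    certificate : Certificate G S r p
    no-isolated : NoIsolated G S
    size≡leaves : count S ≡ leafCount G

tight⇒F_t≡n₁ : ∀ {n} {G : Graph n} → Simple G → Tight G → TotalForcingNumberIs G (leafCount G)
tight⇒F_t≡n₁ {G = G} simple t =
  (S , (certificate⇒forcing certificate , no-isolated) , size≡leaves) , minimal
  where
  open Tight t
  minimal : ∀ S' → TFSet G S' → leafCount G ≤ count S'
  minimal S' (forcing , no-isolated') =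
    ForcerMap.lower-bound G (Simple.symmetric simple) S' rank forcer-map rank-certificate no-isolated'
    where open Rounds.FromForcingSet G S' forcing

module TightFacts {n} {G : Graph n} (sym-G : Symmetric G) (t : Tight G) where
  open Tight t

  -- the neighbour of a colored leaf is colored, as G[S] has no isolated vertex
  leaf-neighbour-colored : ∀ {l v} → IsLeaf G l → Adj G l v → S l ≡ true → S v ≡ true
  leaf-neighbour-colored {l} leaf lv Sl = let (z , Sz , lz) = no-isolated l (true⇒T Sl) in
    T⇒true (subst (λ q → T (S q)) (leaf-unique G leaf lz lv) Sz)

  leaf-forced-by-neighbour : ∀ {l v} → IsLeaf G l → Adj G l v → S l ≡ false → p l ≡ v
  leaf-forced-by-neighbour leaf lv Sl = leaf-unique G leaf (adj-sym sym-G (proj₁ (certificate _ Sl))) lv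

  -- a vertex adjacent to two leaves is colored: otherwise both leaves would
  -- be uncolored and forced by it, contradicting injectivity of the forcer map
  strong-support-colored : ∀ {v} → StrongSupport G v → S v ≡ true
  strong-support-colored {v} (a , b , a≢b , va , vb , leaf-a , leaf-b) with S a in Sa | S b in Sb
  ... | true | _ = leaf-neighbour-colored leaf-a (adj-sym sym-G va) Sa
  ... | false | true = leaf-neighbour-colored leaf-b (adj-sym sym-G vb) Sb
  ... | false | false = ⊥-elim (a≢b (ForcerMap.forcer-injective G sym-G S r p certificate no-isolated a b Sa Sb
          (trans (leaf-forced-by-neighbour leaf-a (adj-sym sym-G va) Sa)
                 (sym (leaf-forced-by-neighbour leaf-b (adj-sym sym-G vb) Sb)))))

tight-iso : ∀ {n} {G H : Graph n} → Tight G → (σ : Fin n ↔ Fin n) →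
  (∀ a b → H (Inverse.to σ a) (Inverse.to σ b) ≡ G a b) → Tight H
tight-iso {n} {G} {H} t σ σ-iso = record
  { S = λ x → S (from x)
  ; r = λ x → r (from x)
  ; p = λ x → to (p (from x))
  ; certificate = certificate'
  ; no-isolated = no-isolated'
  ; size≡leaves = trans same-size (trans size≡leaves (sym same-leaves))
  }
  where
  open Tight t
  to = Inverse.to σ
  from = Inverse.from σ
  to-from : ∀ y → to (from y) ≡ y
  to-from = Inverse.strictlyInverseˡ σ
  from-to : ∀ x → from (to x) ≡ x
  from-to = Inverse.strictlyInverseʳ σ
  H-to : ∀ a y → H (to a) y ≡ G a (from y)
  H-to a y = trans (cong (H (to a)) (sym (to-from y))) (σ-iso a (from y))
  certificate' : Certificate H (λ x → S (from x)) (λ x → r (from x)) (λ x → to (p (from x)))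
  certificate' v Sv =
    let (adj , earlier , others) = certificate (from v) Sv in
    subst T (sym (H-to _ v)) adj ,
    subst (λ q → Earlier S r q (from v)) (sym (from-to _)) earlier ,
    λ w aw w≢v → others (from w) (subst T (H-to _ w) aw)
                   (λ e → w≢v (trans (sym (to-from w)) (trans (cong to e) (to-from v))))
  no-isolated' : NoIsolated H (λ x → S (from x))
  no-isolated' x Sx =
    let (z , Sz , xz) = no-isolated (from x) Sx in
    to z , subst (λ q → T (S q)) (sym (from-to z)) Sz ,
    subst T (sym (trans (cong (λ q → H q (to z)) (sym (to-from x))) (σ-iso (from x) z))) xz
  same-size : count (λ x → S (from x)) ≡ count S
  same-size = trans (sym (count-permute (λ x → S (from x)) σ)) (count-ext (λ x → cong S (from-to x)))
  same-degree : ∀ a → deg H (to a) ≡ deg G a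
  same-degree a = trans (sym (count-permute (H (to a)) σ)) (count-ext (σ-iso a))
  same-leaves : leafCount H ≡ leafCount G
  same-leaves = trans (sym (count-permute (leaf? H) σ)) (count-ext λ a → cong (_≡ᵇ 1) (same-degree a))

tight-P₂ : Tight P₂
tight-P₂ = record
  { S = λ _ → true
  ; r = λ _ → 0
  ; p = λ x → x
  ; certificate = λ v ()
  ; no-isolated = λ { zero _ → suc zero , tt , tt ; (suc zero) _ → zero , tt , tt }
  ; size≡leaves = refl
  }

non-leaf-stable : ∀ d → 2 ≤ d → ∀ k → ((k + d) ≡ᵇ 1) ≡ (d ≡ᵇ 1)
non-leaf-stable d 2≤d k = trans (not-one (ℕ.≤-trans 2≤d (ℕ.m≤n+m d k))) (sym (not-one 2≤d))
  where
  not-one : ∀ {m} → 2 ≤ m → (m ≡ᵇ 1) ≡ false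
  not-one (s≤s (s≤s _)) = refl

strong-support-degree : ∀ {n} {G : Graph n} {v} → StrongSupport G v → 2 ≤ deg G v
strong-support-degree {G = G} {v} (a , b , a≢b , va , vb , _) =
  count-two (G v) (T⇒true va) (T⇒true vb) (≢-sym a≢b)

-- (O2) the new leaf at the strong support vertex v joins the TF-set
tight-O₂ : ∀ {n} {G : Graph n} → Symmetric G → Tight G → (v : Fin n) → StrongSupport G v →
  Tight (addLeaf G v)
tight-O₂ {n} {G} sym-G t v strong = record
  { S = S' ; r = r' ; p = p' ; certificate = certificate' ; no-isolated = no-isolated'
  ; size≡leaves = trans (cong suc size≡leaves) (sym leaves) }
  where
  open Tight t
  G' = addLeaf G v
  S' : Fin (suc n) → Bool
  S' zero = true
  S' (suc a) = S a
  r' : Fin (suc n) → ℕ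
  r' zero = 0
  r' (suc a) = r a
  p' : Fin (suc n) → Fin (suc n)
  p' zero = zero
  p' (suc a) = suc (p a)
  certificate' : Certificate G' S' r' p'
  certificate' zero ()
  certificate' (suc y) Sy =
    let (adj , earlier , others) = certificate y Sy in
    adj , earlier , λ { zero _ _ → inj₁ refl
                      ; (suc w) aw w≢y → others w aw (λ e → w≢y (cong suc e)) }
  no-isolated' : NoIsolated G' S'
  no-isolated' zero _ = suc v , true⇒T (TightFacts.strong-support-colored sym-G t strong) , true⇒T (==-refl v)
  no-isolated' (suc a) Sa = let (z , Sz , az) = no-isolated a Sa in suc z , Sz , az
  old-leaf : ∀ a → leaf? G' (suc a) ≡ leaf? G a
  old-leaf a with a ≟ v
  ... | yes refl = non-leaf-stable (deg G a) (strong-support-degree strong) 1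
  ... | no _ = refl
  leaves : leafCount G' ≡ suc (leafCount G)
  leaves = cong₂ _+_ (cong (λ d → indicator (d ≡ᵇ 1)) (count-== v)) (count-ext old-leaf)

-- (O4) with the path x y z attached by the edge v y, the TF-set gains x
-- and y, and y forces z once v is colored
module O4 {n} {G : Graph n} (t : Tight G) (v : Fin n) (2≤deg : 2 ≤ deg G v) where
  open Tight t
  G' = addP₃ G v
  pattern x = zero
  pattern y = suc zero
  pattern z = suc (suc zero)
  pattern old a = suc (suc (suc a))
  S' : Fin (3 + n) → Bool
  S' (old a) = S a
  S' z = false
  S' _ = true
  r' : Fin (3 + n) → ℕ
  r' (old a) = r a
  r' z = suc (r v)
  r' _ = 0
  p' : Fin (3 + n) → Fin (3 + n)
  p' (old a) = old (p a)
  p' z = y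
  p' u = u
  certificate' : Certificate G' S' r' p'
  certificate' x ()
  certificate' y ()
  certificate' z _ = tt , inj₁ refl , others
    where
    others : ∀ w → Adj G' y w → w ≢ z → Earlier S' r' w z
    others x _ _ = inj₁ refl
    others z _ z≢z = ⊥-elim (z≢z refl)
    others (old b) vb _ = inj₂ (subst (λ q → r q < suc (r v)) (sym (==⇒≡ vb)) ℕ.≤-refl)
  certificate' (old u) Su =
    let (adj , earlier , others) = certificate u Su in
    adj , earlier , λ { y _ _ → inj₁ refl
                      ; (old w) aw w≢u → others w aw (λ e → w≢u (cong old e)) }
  no-isolated' : NoIsolated G' S'
  no-isolated' x _ = y , tt , tt
  no-isolated' y _ = x , tt , tt
  no-isolated' (old a) Sa = let (b , Sb , ab) = no-isolated a Sa in old b , Sb , ab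
  old-leaf : ∀ a → leaf? G' (old a) ≡ leaf? G a
  old-leaf a with a ≟ v
  ... | yes refl = non-leaf-stable (deg G a) 2≤deg 1
  ... | no _ = refl
  -- x and z are the new leaves
  leaves : leafCount G' ≡ 2 + leafCount G
  leaves = cong₂ _+_ (cong (λ d → indicator (suc d ≡ᵇ 1)) (count-none {n} _ (λ _ → refl)))
             (cong₂ _+_ (cong (λ d → indicator (suc (suc d) ≡ᵇ 1)) (count-== v))
               (cong₂ _+_ (cong (λ d → indicator (suc d ≡ᵇ 1)) (count-none {n} _ (λ _ → refl)))
                 (count-ext old-leaf)))

  tight-G' : Tight G'
  tight-G' = record
    { S = S' ; r = r' ; p = p' ; certificate = certificate' ; no-isolated = no-isolated'
    ; size≡leaves = trans (cong (2 +_) size≡leaves) (sym leaves) }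

tight-O₄ : ∀ {n} {G : Graph n} → Tight G → (v : Fin n) → 2 ≤ deg G v → Tight (addP₃ G v)
tight-O₄ = O4.tight-G'

-- (O5) with the gadget u₁ v₁ v₂ v₃ {v₄, u₃} attached by the edge v v₁, the
-- TF-set gains v₃, v₄, u₃; then v₃ forces v₂, v₂ forces v₁, and v₁ forces
-- u₁ once v is colored.  Old ranks are shifted by 3 so that v₁ comes
-- before every old vertex.
module O5 {n} {G : Graph n} (t : Tight G) (v : Fin n) (2≤deg : 2 ≤ deg G v) where
  open Tight t
  G' = addO5 G v
  pattern u₁ = zero
  pattern v₁ = suc zero
  pattern v₂ = suc (suc zero)
  pattern v₃ = suc (suc (suc zero))
  pattern v₄ = suc (suc (suc (suc zero)))
  pattern u₃ = suc (suc (suc (suc (suc zero))))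
  pattern old a = suc (suc (suc (suc (suc (suc a)))))
  S' : Fin (6 + n) → Bool
  S' (old a) = S a
  S' u₁ = false
  S' v₁ = false
  S' v₂ = false
  S' _ = true
  r' : Fin (6 + n) → ℕ
  r' (old a) = 3 + r a
  r' u₁ = 4 + r v
  r' v₁ = 2
  r' v₂ = 1
  r' _ = 0
  p' : Fin (6 + n) → Fin (6 + n)
  p' (old a) = old (p a)
  p' u₁ = v₁
  p' v₁ = v₂
  p' v₂ = v₃
  p' u = u
  shift : ∀ {w y} → Earlier S r w y → Earlier S' r' (old w) (old y)
  shift (inj₁ Sw) = inj₁ Sw
  shift (inj₂ rw<ry) = inj₂ (s≤s (s≤s (s≤s rw<ry)))
  certificate' : Certificate G' S' r' p'
  certificate' u₁ _ = tt , inj₂ (s≤s (s≤s (s≤s z≤n))) , others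
    where
    others : ∀ w → Adj G' v₁ w → w ≢ u₁ → Earlier S' r' w u₁
    others u₁ _ u₁≢u₁ = ⊥-elim (u₁≢u₁ refl)
    others v₂ _ _ = inj₂ (s≤s (s≤s z≤n))
    others (old b) vb _ = inj₂ (subst (λ q → 3 + r q < 4 + r v) (sym (==⇒≡ vb)) ℕ.≤-refl)
  certificate' v₁ _ = tt , inj₂ ℕ.≤-refl , others
    where
    others : ∀ w → Adj G' v₂ w → w ≢ v₁ → Earlier S' r' w v₁
    others v₁ _ v₁≢v₁ = ⊥-elim (v₁≢v₁ refl)
    others v₃ _ _ = inj₁ refl
    others v₄ () _
    others u₃ () _
    others (old _) () _
  certificate' v₂ _ = tt , inj₁ refl , others
    where
    others : ∀ w → Adj G' v₃ w → w ≢ v₂ → Earlier S' r' w v₂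
    others v₂ _ v₂≢v₂ = ⊥-elim (v₂≢v₂ refl)
    others v₄ _ _ = inj₁ refl
    others u₃ _ _ = inj₁ refl
  certificate' v₃ ()
  certificate' v₄ ()
  certificate' u₃ ()
  certificate' (old y) Sy =
    let (adj , earlier , others) = certificate y Sy in
    adj , shift earlier ,
    λ { v₁ _ _ → inj₂ (s≤s (s≤s (s≤s z≤n)))
      ; (old w) aw w≢y → shift (others w aw (λ e → w≢y (cong old e))) }
  no-isolated' : NoIsolated G' S'
  no-isolated' v₃ _ = v₄ , tt , tt
  no-isolated' v₄ _ = v₃ , tt , tt
  no-isolated' u₃ _ = v₃ , tt , tt
  no-isolated' (old a) Sa = let (b , Sb , ab) = no-isolated a Sa in old b , Sb , ab
  old-leaf : ∀ a → leaf? G' (old a) ≡ leaf? G a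
  old-leaf a with a ≟ v
  ... | yes refl = non-leaf-stable (deg G a) 2≤deg 1
  ... | no _ = refl
  -- u₁, v₄ and u₃ are the new leaves
  leaves : leafCount G' ≡ 3 + leafCount G
  leaves = cong₂ _+_ (cong (λ d → indicator (suc d ≡ᵇ 1)) none)
            (cong₂ _+_ (cong (λ d → indicator (suc (suc d) ≡ᵇ 1)) (count-== v))
             (cong₂ _+_ (cong (λ d → indicator (suc (suc d) ≡ᵇ 1)) none)
              (cong₂ _+_ (cong (λ d → indicator (suc (suc (suc d)) ≡ᵇ 1)) none)
               (cong₂ _+_ (cong (λ d → indicator (suc d ≡ᵇ 1)) none)
                (cong₂ _+_ (cong (λ d → indicator (suc d ≡ᵇ 1)) none) (count-ext old-leaf))))))
    where
    none : count {n} (λ _ → false) ≡ 0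
    none = count-none {n} _ (λ _ → refl)

  tight-G' : Tight G'
  tight-G' = record
    { S = S' ; r = r' ; p = p' ; certificate = certificate' ; no-isolated = no-isolated'
    ; size≡leaves = trans (cong (3 +_) size≡leaves) (sym leaves) }

tight-O₅ : ∀ {n} {G : Graph n} → Tight G → (v : Fin n) → 2 ≤ deg G v → Tight (addO5 G v)
tight-O₅ = O5.tight-G'

-- (O3) two new leaves ℓ₁, ℓ₂ at a leaf v whose neighbour w is a strong
-- support vertex.  v stops being a leaf, so n₁ grows by one.  If v is
-- colored, ℓ₁ joins the TF-set and v forces ℓ₂.  Otherwise w forces v;
-- then w has another leaf a, which is colored, and we exchange a for v:
-- the new TF-set is S - a + v + ℓ₁, with w forcing a and v forcing ℓ₂.
module O3 {n} {G : Graph n} (simple : Simple G) (t : Tight G) (w v : Fin n)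
          (strong : StrongSupport G w) (wv : Adj G w v) (leaf-v : IsLeaf G v) where
  open Tight t
  open Simple simple
  open TightFacts symmetric t
  open ForcerMap G symmetric S r p certificate no-isolated using (forcer-injective)

  G' = addTwoLeaves G v
  pattern ℓ₁ = zero
  pattern ℓ₂ = suc zero
  pattern old c = suc (suc c)

  Sw : S w ≡ true
  Sw = strong-support-colored strong

  w≢v : w ≢ v
  w≢v = adj-≢ {G = G} loopless wv

  -- an uncolored vertex is never forced by a leaf l at w: it would be w
  not-forced-by-leaf-at-w : ∀ {l y} → IsLeaf G l → Adj G l w → S y ≡ false → p y ≢ l
  not-forced-by-leaf-at-w {l} {y} leaf lw Sy py≡l =
    false⇒¬T Sy (true⇒T (subst (λ q → S q ≡ true) (sym y≡w) Sw))
    where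
    y≡w : y ≡ w
    y≡w = leaf-unique G leaf (subst (λ q → Adj G q y) py≡l (proj₁ (certificate y Sy))) lw

  leaves : leafCount G' ≡ suc (leafCount G)
  leaves = trans (cong₂ _+_ (cong new-leaf (count-== v)) (cong₂ _+_ (cong new-leaf (count-== v)) refl))
                 (cong suc (sym (count-flip (leaf? G) (λ c → leaf? G' (old c)) v v-was-leaf v-now-not unchanged)))
    where
    new-leaf : ℕ → ℕ
    new-leaf d = indicator (d ≡ᵇ 1)
    v-was-leaf : leaf? G v ≡ true
    v-was-leaf = leaf?-true G leaf-v
    v-now-not : leaf? G' (old v) ≡ false
    v-now-not = trans (cong (λ q → (indicator q + (indicator q + deg G v)) ≡ᵇ 1) (==-refl v))
                      (cong (λ d → (2 + d) ≡ᵇ 1) leaf-v)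
    unchanged : ∀ c → c ≢ v → leaf? G' (old c) ≡ leaf? G c
    unchanged c c≢v = cong (λ q → (indicator q + (indicator q + deg G c)) ≡ᵇ 1) (==-≢ c≢v)

  module ColoredLeaf (Sv : S v ≡ true) where
    S' : Fin (2 + n) → Bool
    S' ℓ₁ = true
    S' ℓ₂ = false
    S' (old c) = S c
    r' : Fin (2 + n) → ℕ
    r' (old c) = r c
    r' _ = 0
    p' : Fin (2 + n) → Fin (2 + n)
    p' ℓ₁ = ℓ₁
    p' ℓ₂ = old v
    p' (old c) = old (p c)
    certificate' : Certificate G' S' r' p'
    certificate' ℓ₁ ()
    certificate' ℓ₂ _ = true⇒T (==-refl v) , inj₁ Sv , others
      where
      others : ∀ x → Adj G' (old v) x → x ≢ ℓ₂ → Earlier S' r' x ℓ₂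
      others ℓ₁ _ _ = inj₁ refl
      others ℓ₂ _ ℓ₂≢ℓ₂ = ⊥-elim (ℓ₂≢ℓ₂ refl)
      others (old c) vc _ = inj₁ (subst (λ q → S q ≡ true) (sym (leaf-unique G leaf-v vc (adj-sym symmetric wv))) Sw)
    certificate' (old y) Sy =
      let (adj , earlier , others) = certificate y Sy in
      adj , earlier , λ { ℓ₁ a _ → ⊥-elim (not-v (==⇒≡ a))
                        ; ℓ₂ a _ → ⊥-elim (not-v (==⇒≡ a))
                        ; (old c) a c≢y → others c a (λ e → c≢y (cong old e)) }
      where
      not-v : p y ≢ v
      not-v = not-forced-by-leaf-at-w leaf-v (adj-sym symmetric wv) Sy
    no-isolated' : NoIsolated G' S'
    no-isolated' ℓ₁ _ = old v , true⇒T Sv , true⇒T (==-refl v)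
    no-isolated' (old c) Sc = let (z , Sz , cz) = no-isolated c Sc in old z , Sz , cz

    tight-G' : Tight G'
    tight-G' = record
      { S = S' ; r = r' ; p = p' ; certificate = certificate' ; no-isolated = no-isolated'
      ; size≡leaves = trans (cong suc size≡leaves) (sym leaves) }

  module UncoloredLeaf (Sv : S v ≡ false) where

    pv≡w : p v ≡ w
    pv≡w = leaf-forced-by-neighbour leaf-v (adj-sym symmetric wv) Sv

    other-leaf : Σ[ a ∈ Fin n ] (a ≢ v × Adj G w a × IsLeaf G a)
    other-leaf = pick strong
      where
      pick : StrongSupport G w → Σ[ a ∈ Fin n ] (a ≢ v × Adj G w a × IsLeaf G a)
      pick (a , b , a≢b , wa , wb , leaf-a , leaf-b) with a ≟ᵥ v
      ... | yes refl = b , ≢-sym a≢b , wb , leaf-b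
      ... | no a≢v = a , a≢v , wa , leaf-a

    a = proj₁ other-leaf
    a≢v = proj₁ (proj₂ other-leaf)
    wa = proj₁ (proj₂ (proj₂ other-leaf))
    leaf-a = proj₂ (proj₂ (proj₂ other-leaf))

    aw : Adj G a w
    aw = adj-sym symmetric wa

    -- a is colored, for otherwise a and v would both be forced by w
    Sa : S a ≡ true
    Sa = ¬-not λ Sa → a≢v (forcer-injective a v Sa Sv (trans (leaf-forced-by-neighbour leaf-a aw Sa) (sym pv≡w)))

    S° : Fin n → Bool
    S° c = (S c ∨ (c == v)) ∧ not (c == a)
    r° : Fin n → ℕ
    r° c = if c == a then r v else r c
    p° : Fin n → Fin (2 + n)
    p° c = if c == a then old w else old (p c)

    S°-a : S° a ≡ false
    S°-a = trans (cong (λ q → (S a ∨ (a == v)) ∧ not q) (==-refl a)) (∧-zeroʳ _)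
    S°-v : S° v ≡ true
    S°-v = trans (cong₂ (λ q₁ q₂ → (S v ∨ q₁) ∧ not q₂) (==-refl v) (==-≢ (≢-sym a≢v)))
                 (trans (∧-identityʳ _) (∨-zeroʳ (S v)))
    S°-kept : ∀ c → S c ≡ true → c ≢ a → S° c ≡ true
    S°-kept c Sc c≢a = cong₂ (λ q₁ q₂ → (q₁ ∨ (c == v)) ∧ not q₂) Sc (==-≢ c≢a)
    S°-other : ∀ c → c ≢ a → c ≢ v → S° c ≡ S c
    S°-other c c≢a c≢v = trans (cong₂ (λ q₁ q₂ → (S c ∨ q₁) ∧ not q₂) (==-≢ c≢v) (==-≢ c≢a))
                               (trans (∧-identityʳ _) (∨-identityʳ _))
    S°-cases : ∀ c → S° c ≡ true → c ≢ a × (c ≡ v ⊎ S c ≡ true)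
    S°-cases c e with c ≟ᵥ a
    ... | yes refl = ⊥-elim (false⇒¬T S°-a (true⇒T e))
    ... | no c≢a with T-∨⁻ {S c} (proj₁ (T-∧⁻ (true⇒T e)))
    ...   | inj₁ Sc = c≢a , inj₂ (T⇒true Sc)
    ...   | inj₂ c==v = c≢a , inj₁ (==⇒≡ c==v)
    r°-a : r° a ≡ r v
    r°-a = cong (λ q → if q then r v else r a) (==-refl a)
    r°-other : ∀ c → c ≢ a → r° c ≡ r c
    r°-other c c≢a = cong (λ q → if q then r v else r c) (==-≢ c≢a)
    p°-a : p° a ≡ old w
    p°-a = cong (λ q → if q then old w else old (p a)) (==-refl a)
    p°-other : ∀ c → c ≢ a → p° c ≡ old (p c)
    p°-other c c≢a = cong (λ q → if q then old w else old (p c)) (==-≢ c≢a)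

    S' : Fin (2 + n) → Bool
    S' ℓ₁ = true
    S' ℓ₂ = false
    S' (old c) = S° c
    r' : Fin (2 + n) → ℕ
    r' (old c) = r° c
    r' _ = 0
    p' : Fin (2 + n) → Fin (2 + n)
    p' ℓ₁ = ℓ₁
    p' ℓ₂ = old v
    p' (old c) = p° c

    lift : ∀ {c y} → c ≢ a → y ≢ a → Earlier S r c y → Earlier S' r' (old c) (old y)
    lift {c} c≢a y≢a (inj₁ Sc) = inj₁ (S°-kept c Sc c≢a)
    lift {c} {y} c≢a y≢a (inj₂ rc<ry) = inj₂ (subst₂ _<_ (sym (r°-other c c≢a)) (sym (r°-other y y≢a)) rc<ry)

    -- w forces a: its other neighbours precede v, which w used to force
    w-forces-a : ForcesAt G' S' r' (old w) (old a)
    w-forces-a = wa , inj₁ (S°-kept w Sw (adj-≢ {G = G} loopless wa)) , others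
      where
      others : ∀ x → Adj G' (old w) x → x ≢ old a → Earlier S' r' x (old a)
      others ℓ₁ wx _ = ⊥-elim (w≢v (==⇒≡ wx))
      others ℓ₂ wx _ = ⊥-elim (w≢v (==⇒≡ wx))
      others (old c) wc x≢a with c ≟ᵥ v
      ... | yes refl = inj₁ S°-v
      ... | no c≢v with proj₂ (proj₂ (certificate v Sv)) c (subst (λ q → Adj G q c) (sym pv≡w) wc) c≢v
      ...   | inj₁ Sc = inj₁ (S°-kept c Sc (λ e → x≢a (cong old e)))
      ...   | inj₂ rc<rv = inj₂ (subst₂ _<_ (sym (r°-other c (λ e → x≢a (cong old e)))) (sym r°-a) rc<rv)

    old-forced : ∀ y → y ≢ a → y ≢ v → S y ≡ false → ForcesAt G' S' r' (old (p y)) (old y)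
    old-forced y y≢a y≢v Sy =
      let (adj , earlier , others) = certificate y Sy in
      adj , lift (not-forced-by-leaf-at-w leaf-a aw Sy) y≢a earlier , others'
      where
      not-v : p y ≢ v
      not-v = not-forced-by-leaf-at-w leaf-v (adj-sym symmetric wv) Sy
      others' : ∀ x → Adj G' (old (p y)) x → x ≢ old y → Earlier S' r' x (old y)
      others' ℓ₁ a' _ = ⊥-elim (not-v (==⇒≡ a'))
      others' ℓ₂ a' _ = ⊥-elim (not-v (==⇒≡ a'))
      others' (old c) pc x≢y with c ≟ᵥ a
      ... | yes refl = ⊥-elim (y≢v (forcer-injective y v Sy Sv
                         (trans (leaf-unique G leaf-a (adj-sym symmetric pc) aw) (sym pv≡w))))
      ... | no c≢a = lift c≢a y≢a (proj₂ (proj₂ (certificate y Sy)) c pc (λ e → x≢y (cong old e)))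

    certificate' : Certificate G' S' r' p'
    certificate' ℓ₁ ()
    certificate' ℓ₂ _ = true⇒T (==-refl v) , inj₁ S°-v , others
      where
      others : ∀ x → Adj G' (old v) x → x ≢ ℓ₂ → Earlier S' r' x ℓ₂
      others ℓ₁ _ _ = inj₁ refl
      others ℓ₂ _ ℓ₂≢ℓ₂ = ⊥-elim (ℓ₂≢ℓ₂ refl)
      others (old c) vc _ = inj₁ (subst (λ q → S° q ≡ true) (sym (leaf-unique G leaf-v vc (adj-sym symmetric wv)))
                                        (S°-kept w Sw (adj-≢ {G = G} loopless wa)))
    certificate' (old y) S°y with y ≟ᵥ a
    ... | yes refl = subst (λ q → ForcesAt G' S' r' q (old y)) (sym p°-a) w-forces-a
    ... | no y≢a = subst (λ q → ForcesAt G' S' r' q (old y)) (sym (p°-other y y≢a))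
                     (old-forced y y≢a y≢v (trans (sym (S°-other y y≢a y≢v)) S°y))
      where
      y≢v : y ≢ v
      y≢v refl = false⇒¬T S°y (true⇒T S°-v)

    no-isolated' : NoIsolated G' S'
    no-isolated' ℓ₁ _ = old v , true⇒T S°-v , true⇒T (==-refl v)
    no-isolated' (old c) S°c with S°-cases c (T⇒true S°c)
    ... | _ , inj₁ refl = ℓ₁ , tt , true⇒T (==-refl c)
    ... | c≢a , inj₂ Sc with no-isolated c (true⇒T Sc)
    ...   | z , Sz , cz with z ≟ᵥ a
    ...     | yes refl = old v , true⇒T S°-v ,
                         subst (λ q → Adj G q v) (sym (leaf-unique G leaf-a (adj-sym symmetric cz) aw)) wv
    ...     | no z≢a = old z , true⇒T (S°-kept z (T⇒true Sz) z≢a) , cz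

    tight-G' : Tight G'
    tight-G' = record
      { S = S' ; r = r' ; p = p' ; certificate = certificate' ; no-isolated = no-isolated'
      ; size≡leaves = trans (cong suc (trans (sym exchanged) size≡leaves)) (sym leaves) }
      where
      exchanged : count S ≡ count S°
      exchanged = count-swap S S° a v Sa Sv S°-a S°-v (λ x x≢a x≢v → S°-other x x≢a x≢v)

tight-O₃ : ∀ {n} {G : Graph n} → Simple G → Tight G → (w v : Fin n) → StrongSupport G w →
  Adj G w v → IsLeaf G v → Tight (addTwoLeaves G v)
tight-O₃ simple t w v strong wv leaf-v with Tight.S t v in Sv
... | true = O3.ColoredLeaf.tight-G' simple t w v strong wv leaf-v Sv
... | false = O3.UncoloredLeaf.tight-G' simple t w v strong wv leaf-v Sv

-- (O1) subdividing an edge uv by a new vertex x.  Degrees of old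
-- vertices, hence n₁, are unchanged.  If u forces v, then u forces x and
-- x forces v.  If neither endpoint forces the other and deg u ≤ 2, then
-- u and v are colored and v is the only colored neighbour of u; x replaces
-- u in the TF-set and forces u.
module O1 {n} {G : Graph n} (simple : Simple G) (t : Tight G) (u v : Fin n) (uv : Adj G u v) where
  open Tight t
  open Simple simple

  G' = subdivide G u v
  pattern x = zero
  pattern old a = suc a

  u≢v : u ≢ v
  u≢v = adj-≢ {G = G} loopless uv

  IsUV : Fin n → Fin n → Bool
  IsUV a b = ((a == u) ∧ (b == v)) ∨ ((a == v) ∧ (b == u))

  not-uv : ∀ {a b} → (a ≢ u ⊎ b ≢ v) → (a ≢ v ⊎ b ≢ u) → IsUV a b ≡ false
  not-uv h₁ h₂ = cong₂ _∨_ (not-pair h₁) (not-pair h₂)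
    where
    not-pair : ∀ {a b a' b' : Fin n} → (a ≢ a' ⊎ b ≢ b') → ((a == a') ∧ (b == b')) ≡ false
    not-pair {b = b} {b' = b'} (inj₁ a≢a') = cong (_∧ (b == b')) (==-≢ a≢a')
    not-pair {a = a} {a' = a'} (inj₂ b≢b') = trans (cong ((a == a') ∧_) (==-≢ b≢b')) (∧-zeroʳ _)

  old-adj : ∀ {a b} → Adj G a b → (a ≢ u ⊎ b ≢ v) → (a ≢ v ⊎ b ≢ u) → Adj G' (old a) (old b)
  old-adj {a} {b} ab h₁ h₂ = subst T (sym (cong₂ (λ e f → e ∧ not f) (T⇒true ab) (not-uv h₁ h₂))) tt

  old-adj⁻ : ∀ {a b} → Adj G' (old a) (old b) → Adj G a b
  old-adj⁻ {a} {b} ab = proj₁ (T-∧⁻ {G a b} ab)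

  uv-removed : ¬ Adj G' (old u) (old v)
  uv-removed = false⇒¬T (trans (cong (λ q → G u v ∧ not (q ∨ ((u == v) ∧ (v == u))))
                                     (cong₂ _∧_ (==-refl u) (==-refl v))) (∧-zeroʳ _))

  xu : Adj G' x (old u)
  xu = T-∨⁺ (inj₁ (true⇒T (==-refl u)))

  xv : Adj G' x (old v)
  xv = T-∨⁺ {v == u} (inj₂ (true⇒T (==-refl v)))

  vx : Adj G' (old v) x
  vx = T-∨⁺ {v == u} (inj₂ (true⇒T (==-refl v)))

  x-neighbours : ∀ {b} → Adj G' x (old b) → b ≡ u ⊎ b ≡ v
  x-neighbours {b} xb with T-∨⁻ {b == u} xb
  ... | inj₁ b==u = inj₁ (==⇒≡ b==u)
  ... | inj₂ b==v = inj₂ (==⇒≡ b==v)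

  -- u and v trade the neighbour v resp. u for x
  same-degree : ∀ a → deg G' (old a) ≡ deg G a
  same-degree a with a ≟ᵥ u | a ≟ᵥ v
  ... | yes refl | _ =
    trans (cong₂ (λ q c → indicator q + c) (cong (_∨ (a == v)) (==-refl a))
            (count-ext λ b → cong (λ q → G a b ∧ not q)
              (trans (cong₂ (λ q₁ q₂ → (q₁ ∧ (b == v)) ∨ (q₂ ∧ (b == a))) (==-refl a) (==-≢ u≢v))
                     (∨-identityʳ _))))
          (sym (count-remove (G a) v (T⇒true uv)))
  ... | no _ | yes refl =
    trans (cong₂ (λ q c → indicator q + c) (trans (cong ((a == u) ∨_) (==-refl a)) (∨-zeroʳ _))
            (count-ext λ b → cong (λ q → G a b ∧ not q)
              (cong₂ (λ q₁ q₂ → (q₁ ∧ (b == a)) ∨ (q₂ ∧ (b == u))) (==-≢ (≢-sym u≢v)) (==-refl a))))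
          (sym (count-remove (G a) u (T⇒true (adj-sym symmetric uv))))
  ... | no a≢u | no a≢v =
    cong₂ (λ q c → indicator q + c) (cong₂ _∨_ (==-≢ a≢u) (==-≢ a≢v))
      (count-ext λ b → trans (cong (λ q → G a b ∧ not q) (not-uv (inj₁ a≢u) (inj₁ a≢v))) (∧-identityʳ _))

  -- x has degree 2, so it is not a leaf
  leaves : leafCount G' ≡ leafCount G
  leaves = cong₂ _+_ (cong indicator (leaf?-false G' {x} x-not-leaf)) (count-ext λ a → cong (_≡ᵇ 1) (same-degree a))
    where
    x-not-leaf : ¬ IsLeaf G' x
    x-not-leaf leaf = ℕ.<-irrefl (sym leaf)
      (count-two (G' x) (T⇒true xu) (T⇒true xv) (λ e → u≢v (sym (suc-injective e))))

  -- u forces v in G: the new vertex x is forced by u and forces v.  Old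
  -- ranks are doubled (and shifted) to make room for x between them.
  module ForcingEdge (Sv : S v ≡ false) (pv≡u : p v ≡ u) where
    S' : Fin (suc n) → Bool
    S' x = false
    S' (old a) = S a
    r' : Fin (suc n) → ℕ
    r' x = r v + r v
    r' (old a) = suc (r a + r a)
    p' : Fin (suc n) → Fin (suc n)
    p' x = old u
    p' (old a) = if a == v then x else old (p a)

    p'-v : p' (old v) ≡ x
    p'-v = cong (λ q → if q then x else old (p v)) (==-refl v)
    p'-other : ∀ a → a ≢ v → p' (old a) ≡ old (p a)
    p'-other a a≢v = cong (λ q → if q then x else old (p a)) (==-≢ a≢v)

    u-before-v : Earlier S r u v
    u-before-v = subst (λ q → Earlier S r q v) pv≡u (proj₁ (proj₂ (certificate v Sv)))
    others-before-v : ∀ c → Adj G u c → c ≢ v → Earlier S r c v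
    others-before-v c uc c≢v = proj₂ (proj₂ (certificate v Sv)) c (subst (λ q → Adj G q c) (sym pv≡u) uc) c≢v
    pu≢v : S u ≡ false → p u ≢ v
    pu≢v Su pu≡v with u-before-v | subst (λ q → Earlier S r q u) pu≡v (proj₁ (proj₂ (certificate u Su)))
    ... | inj₁ Su' | _ = false⇒¬T Su (true⇒T Su')
    ... | _ | inj₁ Sv' = false⇒¬T Sv (true⇒T Sv')
    ... | inj₂ ru<rv | inj₂ rv<ru = ℕ.<-asym ru<rv rv<ru

    double< : ∀ {a b} → a < b → suc (a + a) < b + b
    double< {a} {b} a<b = subst (_≤ b + b) (cong suc (ℕ.+-suc a a)) (ℕ.+-mono-≤ a<b a<b)
    lift : ∀ {c y} → Earlier S r c y → Earlier S' r' (old c) (old y)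
    lift (inj₁ Sc) = inj₁ Sc
    lift (inj₂ rc<ry) = inj₂ (s≤s (ℕ.<-trans (ℕ.n<1+n _) (double< rc<ry)))
    before-x : ∀ {c} → Earlier S r c v → Earlier S' r' (old c) x
    before-x (inj₁ Sc) = inj₁ Sc
    before-x (inj₂ rc<rv) = inj₂ (double< rc<rv)

    u-forces-x : ForcesAt G' S' r' (old u) x
    u-forces-x = xu , before-x u-before-v , others
      where
      others : ∀ y → Adj G' (old u) y → y ≢ x → Earlier S' r' y x
      others x _ x≢x = ⊥-elim (x≢x refl)
      others (old c) uc _ with c ≟ᵥ v
      ... | yes refl = ⊥-elim (uv-removed uc)
      ... | no c≢v = before-x (others-before-v c (old-adj⁻ uc) c≢v)

    x-forces-v : ForcesAt G' S' r' x (old v)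
    x-forces-v = xv , inj₂ ℕ.≤-refl , others
      where
      others : ∀ y → Adj G' x y → y ≢ old v → Earlier S' r' y (old v)
      others (old b) xb y≢v with x-neighbours {b} xb
      ... | inj₁ refl = lift u-before-v
      ... | inj₂ refl = ⊥-elim (y≢v refl)

    old-forced : ∀ y → y ≢ v → S y ≡ false → ForcesAt G' S' r' (old (p y)) (old y)
    old-forced y y≢v Sy =
      let (adj , earlier , others) = certificate y Sy in
      old-adj adj (inj₂ y≢v) not-vu , lift earlier , others'
      where
      not-vu : p y ≢ v ⊎ y ≢ u
      not-vu with y ≟ᵥ u
      ... | yes refl = inj₁ (pu≢v Sy)
      ... | no y≢u = inj₂ y≢u
      v-before : Earlier S r v y → r v ≤ r y
      v-before (inj₁ Sv') = ⊥-elim (false⇒¬T Sv (true⇒T Sv'))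
      v-before (inj₂ rv<ry) = ℕ.<⇒≤ rv<ry
      rv≤ry : Adj G' (old (p y)) x → r v ≤ r y
      rv≤ry px with T-∨⁻ {p y == u} px
      ... | inj₁ py==u = v-before (proj₂ (proj₂ (certificate y Sy)) v
                           (subst (λ q → Adj G q v) (sym (==⇒≡ py==u)) uv) (≢-sym y≢v))
      ... | inj₂ py==v = v-before (subst (λ q → Earlier S r q y) (==⇒≡ py==v) (proj₁ (proj₂ (certificate y Sy))))
      others' : ∀ z → Adj G' (old (p y)) z → z ≢ old y → Earlier S' r' z (old y)
      others' x px _ = inj₂ (s≤s (ℕ.+-mono-≤ (rv≤ry px) (rv≤ry px)))
      others' (old c) pc c≢y = lift (proj₂ (proj₂ (certificate y Sy)) c (old-adj⁻ pc) (λ e → c≢y (cong old e)))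

    certificate' : Certificate G' S' r' p'
    certificate' x _ = u-forces-x
    certificate' (old y) Sy with y ≟ᵥ v
    ... | yes refl = subst (λ q → ForcesAt G' S' r' q (old y)) (sym p'-v) x-forces-v
    ... | no y≢v = subst (λ q → ForcesAt G' S' r' q (old y)) (sym (p'-other y y≢v)) (old-forced y y≢v Sy)

    no-isolated' : NoIsolated G' S'
    no-isolated' (old a) Sa =
      let (z , Sz , az) = no-isolated a Sa in
      old z , Sz , old-adj az (inj₂ (λ { refl → false⇒¬T Sv Sz })) (inj₁ (λ { refl → false⇒¬T Sv Sa }))

    tight-G' : Tight G'
    tight-G' = record
      { S = S' ; r = r' ; p = p' ; certificate = certificate' ; no-isolated = no-isolated'
      ; size≡leaves = trans size≡leaves (sym leaves) }

  module ColoredEdge (Su : S u ≡ true) (Sv : S v ≡ true) (only-v : ∀ z → Adj G u z → S z ≡ true → z ≡ v) where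
    S' : Fin (suc n) → Bool
    S' x = true
    S' (old a) = S a ∧ not (a == u)
    r' : Fin (suc n) → ℕ
    r' x = 0
    r' (old a) = if a == u then 0 else suc (r a)
    p' : Fin (suc n) → Fin (suc n)
    p' x = x
    p' (old a) = if a == u then x else old (p a)

    S'-u : S' (old u) ≡ false
    S'-u = trans (cong (λ q → S u ∧ not q) (==-refl u)) (∧-zeroʳ _)
    S'-other : ∀ a → a ≢ u → S' (old a) ≡ S a
    S'-other a a≢u = trans (cong (λ q → S a ∧ not q) (==-≢ a≢u)) (∧-identityʳ _)
    r'-u : r' (old u) ≡ 0
    r'-u = cong (λ q → if q then 0 else suc (r u)) (==-refl u)
    r'-other : ∀ a → a ≢ u → r' (old a) ≡ suc (r a)
    r'-other a a≢u = cong (λ q → if q then 0 else suc (r a)) (==-≢ a≢u)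
    p'-u : p' (old u) ≡ x
    p'-u = cong (λ q → if q then x else old (p u)) (==-refl u)
    p'-other : ∀ a → a ≢ u → p' (old a) ≡ old (p a)
    p'-other a a≢u = cong (λ q → if q then x else old (p a)) (==-≢ a≢u)

    -- u, now of rank 0, comes before every other uncolored vertex
    lift : ∀ {c y} → y ≢ u → Earlier S r c y → Earlier S' r' (old c) (old y)
    lift {c} {y} y≢u earlier with c ≟ᵥ u
    ... | yes refl = inj₂ (subst₂ _<_ (sym r'-u) (sym (r'-other y y≢u)) (s≤s z≤n))
    lift {c} {y} y≢u (inj₁ Sc) | no c≢u = inj₁ (trans (S'-other c c≢u) Sc)
    lift {c} {y} y≢u (inj₂ rc<ry) | no c≢u =
      inj₂ (subst₂ _<_ (sym (r'-other c c≢u)) (sym (r'-other y y≢u)) (s≤s rc<ry))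

    x-forces-u : ForcesAt G' S' r' x (old u)
    x-forces-u = xu , inj₁ refl , others
      where
      others : ∀ y → Adj G' x y → y ≢ old u → Earlier S' r' y (old u)
      others (old b) xb y≢u with x-neighbours {b} xb
      ... | inj₁ refl = ⊥-elim (y≢u refl)
      ... | inj₂ refl = inj₁ (trans (S'-other b (≢-sym u≢v)) Sv)

    old-forced : ∀ y → y ≢ u → S y ≡ false → ForcesAt G' S' r' (old (p y)) (old y)
    old-forced y y≢u Sy =
      let (adj , earlier , others) = certificate y Sy in
      old-adj adj (inj₂ y≢v) (inj₂ y≢u) , lift y≢u earlier , others'
      where
      y≢v : y ≢ v
      y≢v refl = false⇒¬T Sy (true⇒T Sv)
      others' : ∀ z → Adj G' (old (p y)) z → z ≢ old y → Earlier S' r' z (old y)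
      others' x _ _ = inj₁ refl
      others' (old c) pc c≢y = lift y≢u (proj₂ (proj₂ (certificate y Sy)) c (old-adj⁻ pc) (λ e → c≢y (cong old e)))

    certificate' : Certificate G' S' r' p'
    certificate' x ()
    certificate' (old y) S'y with y ≟ᵥ u
    ... | yes refl = subst (λ q → ForcesAt G' S' r' q (old y)) (sym p'-u) x-forces-u
    ... | no y≢u = subst (λ q → ForcesAt G' S' r' q (old y)) (sym (p'-other y y≢u))
                     (old-forced y y≢u (trans (sym (S'-other y y≢u)) S'y))

    no-isolated' : NoIsolated G' S'
    no-isolated' x _ = old v , true⇒T (trans (S'-other v (≢-sym u≢v)) Sv) , xv
    no-isolated' (old a) S'a with a ≟ᵥ u
    ... | yes refl = ⊥-elim (false⇒¬T S'-u S'a)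
    ... | no a≢u = old-neighbour (no-isolated a (true⇒T Sa))
      where
      Sa : S a ≡ true
      Sa = trans (sym (S'-other a a≢u)) (T⇒true S'a)
      -- a colored neighbour of a in G, other than u, remains one; if it is
      -- u then a = v, which is adjacent to the colored x
      old-neighbour : Σ[ z ∈ Fin n ] (T (S z) × Adj G a z) → Σ[ z ∈ _ ] (T (S' z) × Adj G' (old a) z)
      old-neighbour (z , Sz , az) with z ≟ᵥ u
      ... | yes refl = x , tt , subst (λ q → Adj G' (old q) x) (sym (only-v a (adj-sym symmetric az) Sa)) vx
      ... | no z≢u = old z , true⇒T (trans (S'-other z z≢u) (T⇒true Sz)) , old-adj az (inj₁ a≢u) (inj₂ z≢u)

    tight-G' : Tight G'
    tight-G' = record
      { S = S' ; r = r' ; p = p' ; certificate = certificate' ; no-isolated = no-isolated'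
      ; size≡leaves = trans (sym (count-remove S u Su)) (trans size≡leaves (sym leaves)) }

  -- if neither endpoint forces the other and deg u ≤ 2, we are in the
  -- previous case: a leaf u would be forced by v, and a degree-2 vertex u
  -- forces some vertex (the TF-set is tight), which must be its other
  -- neighbour w; then u is colored, since w and u cannot force each other
  colored-edge : ¬ (S v ≡ false × p v ≡ u) → ¬ (S u ≡ false × p u ≡ v) → deg G u ≤ 2 →
    S u ≡ true × S v ≡ true × (∀ z → Adj G u z → S z ≡ true → z ≡ v)
  colored-edge ¬v-forced ¬u-forced deg≤2 with deg G u in deg-u | count-pos (G u) v (T⇒true uv)
  colored-edge ¬v-forced ¬u-forced (s≤s (s≤s z≤n)) | 2 | _ = Su , Sv , only-v
    where
    open ForcerMap G symmetric S r p certificate no-isolated using (forcer-onto; earlier-uncolored)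
    W = count-two-other (G u) (T⇒true uv) deg-u
    w = proj₁ W
    u-neighbours : ∀ {z} → Adj G u z → z ≡ v ⊎ z ≡ w
    u-neighbours {z} uz = proj₂ (proj₂ W) z (T⇒true uz)
    Y = forcer-onto size≡leaves u (λ leaf → ℕ.<-irrefl refl (subst (1 <_) (trans (sym deg-u) leaf) (s≤s (s≤s z≤n))))
    y = proj₁ Y
    Sy = proj₁ (proj₂ Y)
    py≡u = proj₂ (proj₂ Y)
    w-forced-by-u : S w ≡ false × p w ≡ u
    w-forced-by-u with u-neighbours (subst (λ q → Adj G q y) py≡u (proj₁ (certificate y Sy)))
    ... | inj₁ y≡v = ⊥-elim (¬v-forced (subst (λ q → S q ≡ false × p q ≡ u) y≡v (Sy , py≡u)))
    ... | inj₂ y≡w = subst (λ q → S q ≡ false × p q ≡ u) y≡w (Sy , py≡u)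
    Su : S u ≡ true
    Su = ¬-not λ Su → uncolored-u Su (u-neighbours (adj-sym symmetric (proj₁ (certificate u Su))))
      where
      uncolored-u : (Su : S u ≡ false) → p u ≡ v ⊎ p u ≡ w → ⊥
      uncolored-u Su (inj₁ pu≡v) = ¬u-forced (Su , pu≡v)
      uncolored-u Su (inj₂ pu≡w) = ℕ.<-asym
        (earlier-uncolored (proj₁ w-forced-by-u) (subst (λ q → Earlier S r q u) pu≡w (proj₁ (proj₂ (certificate u Su)))))
        (earlier-uncolored Su (subst (λ q → Earlier S r q w) (proj₂ w-forced-by-u)
                                      (proj₁ (proj₂ (certificate w (proj₁ w-forced-by-u))))))
    only-v : ∀ z → Adj G u z → S z ≡ true → z ≡ v
    only-v z uz Sz with u-neighbours uz
    ... | inj₁ z≡v = z≡v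
    ... | inj₂ refl = ⊥-elim (false⇒¬T (proj₁ w-forced-by-u) (true⇒T Sz))
    Sv : S v ≡ true
    Sv = let (z , Sz , uz) = no-isolated u (true⇒T Su) in
         subst (λ q → S q ≡ true) (only-v z uz (T⇒true Sz)) (T⇒true Sz)
  colored-edge _ _ _ | 0 | ()
  colored-edge ¬v-forced ¬u-forced (s≤s z≤n) | 1 | _ = Su , Sv , λ z uz _ → u-neighbour uz
    where
    u-neighbour : ∀ {z} → Adj G u z → z ≡ v
    u-neighbour uz = leaf-unique G deg-u uz uv
    Su : S u ≡ true
    Su = ¬-not λ Su → ¬u-forced (Su , u-neighbour (adj-sym symmetric (proj₁ (certificate u Su))))
    Sv : S v ≡ true
    Sv = let (z , Sz , uz) = no-isolated u (true⇒T Su) in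
         subst (λ q → S q ≡ true) (u-neighbour uz) (T⇒true Sz)

subdivide-swap : ∀ {n} (G : Graph n) u v a b → subdivide G u v a b ≡ subdivide G v u a b
subdivide-swap G u v zero zero = refl
subdivide-swap G u v zero (suc b) = ∨-comm (b == u) (b == v)
subdivide-swap G u v (suc a) zero = ∨-comm (a == u) (a == v)
subdivide-swap G u v (suc a) (suc b) =
  cong (λ q → G a b ∧ not q) (∨-comm ((a == u) ∧ (b == v)) ((a == v) ∧ (b == u)))

forced-by? : ∀ {n} (b : Bool) (x y : Fin n) → Dec (b ≡ false × x ≡ y)
forced-by? true x y = no λ { (() , _) }
forced-by? false x y with x ≟ y
... | yes x≡y = yes (refl , x≡y)
... | no x≢y = no λ { (_ , x≡y) → x≢y x≡y }

-- the subdivisions of uv and of vu are the same graph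
tight-subdivide-swap : ∀ {n} {G : Graph n} (u v : Fin n) → Tight (subdivide G v u) → Tight (subdivide G u v)
tight-subdivide-swap {G = G} u v t = tight-iso t (↔-id _) (subdivide-swap G u v)

tight-colored-edge : ∀ {n} {G : Graph n} → Simple G → (t : Tight G) → (u v : Fin n) → Adj G u v →
  ¬ (Tight.S t v ≡ false × Tight.p t v ≡ u) → ¬ (Tight.S t u ≡ false × Tight.p t u ≡ v) →
  deg G u ≤ 2 → Tight (subdivide G u v)
tight-colored-edge simple t u v uv ¬v-forced ¬u-forced deg-u =
  let (Su , Sv , only-v) = O1.colored-edge simple t u v uv ¬v-forced ¬u-forced deg-u
  in O1.ColoredEdge.tight-G' simple t u v uv Su Sv only-v

tight-O₁ : ∀ {n} {G : Graph n} → Simple G → Tight G → (u v : Fin n) → Adj G u v →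
  (deg G u ≤ 2 ⊎ deg G v ≤ 2) → Tight (subdivide G u v)
tight-O₁ simple t u v uv small
  with forced-by? (Tight.S t v) (Tight.p t v) u | forced-by? (Tight.S t u) (Tight.p t u) v
... | yes (Sv , pv≡u) | _ = O1.ForcingEdge.tight-G' simple t u v uv Sv pv≡u
... | no _ | yes (Su , pu≡v) =
  tight-subdivide-swap u v (O1.ForcingEdge.tight-G' simple t v u (adj-sym (Simple.symmetric simple) uv) Su pu≡v)
... | no ¬v-forced | no ¬u-forced with small
...   | inj₁ deg-u = tight-colored-edge simple t u v uv ¬v-forced ¬u-forced deg-u
...   | inj₂ deg-v = tight-subdivide-swap u v
          (tight-colored-edge simple t v u (adj-sym (Simple.symmetric simple) uv) ¬u-forced ¬v-forced deg-v)

tight : ∀ {n} {T : Graph n} → InF n T → Tight T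
tight p₂ = tight-P₂
tight (o₁ i u v uv small) = tight-O₁ (inF-simple i) (tight i) u v uv small
tight (o₂ i v strong) = tight-O₂ (Simple.symmetric (inF-simple i)) (tight i) v strong
tight (o₃ i w v strong wv leaf) = tight-O₃ (inF-simple i) (tight i) w v strong wv leaf
tight (o₄ i v 2≤deg) = tight-O₄ (tight i) v 2≤deg
tight (o₅ i v 2≤deg) = tight-O₅ (tight i) v 2≤deg
tight (iso i σ σ-iso) = tight-iso (tight i) σ σ-iso

lemma5 : ∀ {n : ℕ} {T : Graph n} → InF n T → TotalForcingNumberIs T (leafCount T)
lemma5 i = tight⇒F_t≡n₁ (inF-simple i) (tight i)
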